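{- Let $p$ be an odd prime and let $q\in\mathbb{C}_p$ with $|1-q|_p<1$. For $m,n,k\in\mathbb{Z}_+$ with $m+n>2k$, $$\sum_{j=0}^{n+m-2k}\binom{n+m-2k}{j}(-1)^jE_{j+2k,q^{ -1}}=\begin{cases}2+\frac{1}{q}E_{n+m,q}, & k=0,\\[1mm] \frac{1}{q}\displaystyle\sum_{j=0}^{2k}\binom{2k}{j}(-1)^{j+2k}E_{n+m-j,q}, & k>0.\end{cases}$$
   Context: $\mathbb{C}_p$ denotes the completion of an algebraic closure of $\mathbb{Q}_p$; $\mathbb{Z}_+=\{0,1,2,\dots\}$. For $q\in\mathbb{C}_p$ with $|1-q|_p<1$, the $q$-Euler numbers $E_{n,q}$ are defined by $\frac{2}{qe^t+1}=\sum_{n\ge0}E_{n,q}\frac{t^n}{n!}$ (formal power series in $t$), and $E_{n,q^{ -1}}$ denotes the same numbers with $q$ replaced by $q^{ -1}$. -}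

module Defs where

open import Level using (Level)
open import Algebra.Bundles using (CommutativeRing)
open import Data.Nat using (ℕ; zero; suc)
open import Data.Nat.Combinatorics using (_C_)
open import Data.Fin using (Fin; toℕ; fromℕ)
open import Data.Vec using (Vec; []; _∷ʳ_; lookup)

module QEuler {c ℓ : Level} (R : CommutativeRing c ℓ) where
  open CommutativeRing R public

  fromℕ' : ℕ → Carrier
  fromℕ' zero    = 0#
  fromℕ' (suc n) = 1# + fromℕ' n

  pow : Carrier → ℕ → Carrier
  pow x zero    = 1#
  pow x (suc n) = x * pow x n

  sgn : ℕ → Carrier
  sgn j = pow (- 1#) j

  sumTo : ℕ → (ℕ → Carrier) → Carrier
  sumTo zero    f = f 0
  sumTo (suc N) f = sumTo N f + f (suc N)

  sumFin : (n : ℕ) → (Fin n → Carrier) → Carrier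
  sumFin zero    f = 0#
  sumFin (suc n) f = f (fromℕ n) + sumFin n (λ i → f (Data.Fin.inject₁ i))

  δ0 : ℕ → Carrier
  δ0 zero    = 1#
  δ0 (suc n) = 0#

  -- Coefficient extraction from 2 = (q e^t + 1) Σ E_n t^n/n!  gives, for every n,
  --   q Σ_{j=0}^{n} C(n,j) E_j + E_n = 2 δ_{n,0},
  -- i.e. (q+1) E_n = 2 δ_{n,0} - q Σ_{j<n} C(n,j) E_j.
  -- Here w is the inverse of (q + 1).
  -- table q w n = (E_{0,q}, …, E_{n-1,q})
  table : Carrier → Carrier → (n : ℕ) → Vec Carrier n
  table q w zero    = []
  table q w (suc n) =
    let v = table q w n in
    v ∷ʳ (w * ((1# + 1#) * δ0 n
                + - (q * sumFin n (λ i → fromℕ' (n C toℕ i) * lookup v i))))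

  qEuler : Carrier → Carrier → ℕ → Carrier
  qEuler q w n = lookup (table q w (suc n)) (fromℕ n)

case0 : {a : Level} {A : Set a} → ℕ → A → A → A
case0 zero    x y = x
case0 (suc k) x y = y

module Submission where

-- Write E n = E_{n,q} and E' n = E_{n,q⁻¹}.  Comparing coefficients in
-- 2 = (q e^t + 1) Σ E n tⁿ/n!  gives the Euler recurrence
--     q Σ_{j≤t} C(t,j) E j + E t = 2 δ_{t,0},
-- which determines E as soon as q + 1 is invertible.  In umbral notation
-- (Eⁿ stands for E n) it reads  q (E+1)ᵗ + Eᵗ = 2 δ_t,  and Pascal's rule
-- propagates it, by induction on s, to the two identities
--     (P)  q Eˢ (E+1)ᵗ + Eᵗ (E-1)ˢ        = 2 δ_t (-1)ˢ,
--     (Q)  q (-1)ˢ Eˢ (E+1)ᵗ + Eᵗ (1-E)ˢ  = 2 δ_t.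
-- Identity (Q) at t = 0 says that n ↦ 2 δ_n - (-1)ⁿ E n satisfies the Euler
-- recurrence for q⁻¹, so by uniqueness it is E' (the reflection formula,
-- i.e. 2/(q⁻¹eᵗ+1) = 2 - 2/(qe⁻ᵗ+1)).  Substituting the reflection formula
-- into Σ_j C(r,j)(-1)ʲ E'(j+K) leaves 2 δ_K - (-1)ᴷ Eᴷ (E+1)ʳ, and for r > 0
-- identity (P) rewrites Eᴷ (E+1)ʳ as -q⁻¹ Eʳ (E-1)ᴷ.  With r = n+m-2k and
-- K = 2k this is the corollary.

open import Defs
open import Level using (Level)
open import Algebra.Bundles using (CommutativeRing)
open import Data.Nat using (ℕ; zero; suc; _≤_; _<_; z≤n; s≤s)
import Data.Nat as N
import Data.Nat.Properties as NP
open import Data.Nat.Combinatorics using (_C_; nCn≡1; k>n⇒nCk≡0; nCk+nC[k+1]≡[n+1]C[k+1])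
open import Data.Nat.Induction using (<-rec)
open import Data.Fin using (Fin; toℕ; fromℕ; inject₁)
import Data.Fin as F
open import Data.Fin.Properties using (toℕ-fromℕ; toℕ-inject₁)
open import Data.Fin.Relation.Unary.Top using (view; ‵fromℕ; ‵inject₁)
open import Data.Vec using (Vec; []; _∷_; _∷ʳ_; lookup)
import Relation.Binary.PropositionalEquality as P
import Relation.Binary.Reasoning.Setoid as SetoidReasoning

lookup-∷ʳ-last : ∀ {a} {A : Set a} {n} (v : Vec A n) x → lookup (v ∷ʳ x) (fromℕ n) P.≡ x
lookup-∷ʳ-last []      x = P.refl
lookup-∷ʳ-last (y ∷ v) x = lookup-∷ʳ-last v x

lookup-∷ʳ-init : ∀ {a} {A : Set a} {n} (v : Vec A n) x (i : Fin n) →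
                 lookup (v ∷ʳ x) (inject₁ i) P.≡ lookup v i
lookup-∷ʳ-init (y ∷ v) x F.zero    = P.refl
lookup-∷ʳ-init (y ∷ v) x (F.suc i) = lookup-∷ʳ-init v x i

module QEulerProperties {c ℓ : Level} (R : CommutativeRing c ℓ) where
  open QEuler R
  open SetoidReasoning setoid
  open import Algebra.Properties.Ring ring
    using ( -1*x≈-x; -‿distribˡ-*; -‿distribʳ-*; -‿involutive; -‿+-comm; -0#≈0#
          ; xyx⁻¹≈y; +-cancelˡ; +-inverseʳ-unique; x[y-z]≈xy-xz)
  open import Algebra.Properties.CommutativeSemigroup +-commutativeSemigroup
    using (interchange; x∙yz≈xz∙y)
  open import Algebra.Properties.CommutativeSemigroup *-commutativeSemigroup
    using (x∙yz≈y∙xz)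

  two : Carrier
  two = 1# + 1#

  add-sub : ∀ x y → x + (y + - x) ≈ y
  add-sub x y = trans (sym (+-assoc x y (- x))) (xyx⁻¹≈y x y)

  move-right : ∀ {a b r} → a + b ≈ r → r + - b ≈ a
  move-right {a} {b} e = trans (+-congʳ (sym e)) (trans (+-congʳ (+-comm a b)) (xyx⁻¹≈y b a))

  -- Subtracting two instances of a relation  q X + W.
  subtract-relations : ∀ {X X' Y} q W Z → X' ≈ X + Y →
                       q * Y + (W + - Z) ≈ (q * X' + W) + - (q * X + Z)
  subtract-relations {X} {X'} {Y} q W Z X'≈X+Y = sym (begin
    (q * X' + W) + - (q * X + Z)         ≈⟨ +-cong (+-congʳ (*-congˡ X'≈X+Y)) (sym (-‿+-comm _ _)) ⟩
    (q * (X + Y) + W) + (- (q * X) + - Z) ≈⟨ +-congʳ (+-congʳ (distribˡ q X Y)) ⟩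
    ((q * X + q * Y) + W) + (- (q * X) + - Z) ≈⟨ +-congʳ (+-assoc _ _ _) ⟩
    (q * X + (q * Y + W)) + (- (q * X) + - Z) ≈⟨ interchange _ _ _ _ ⟩
    (q * X + - (q * X)) + ((q * Y + W) + - Z) ≈⟨ +-congʳ (-‿inverseʳ _) ⟩
    0# + ((q * Y + W) + - Z)              ≈⟨ +-identityˡ _ ⟩
    (q * Y + W) + - Z                     ≈⟨ +-assoc _ _ _ ⟩
    q * Y + (W + - Z)                     ∎)

  negate-middle : ∀ a b x → a * ((- 1# * b) * x) ≈ - (a * (b * x))
  negate-middle a b x = begin
    a * ((- 1# * b) * x) ≈⟨ *-congˡ (*-assoc _ _ _) ⟩
    a * (- 1# * (b * x)) ≈⟨ *-congˡ (-1*x≈-x _) ⟩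
    a * - (b * x)        ≈⟨ -‿distribʳ-* _ _ ⟨
    - (a * (b * x))      ∎

  split-top : ∀ q L a → q * (L + a) + a ≈ q * L + (q + 1#) * a
  split-top q L a = begin
    q * (L + a) + a           ≈⟨ +-congʳ (distribˡ q L a) ⟩
    (q * L + q * a) + a       ≈⟨ +-assoc _ _ _ ⟩
    q * L + (q * a + a)       ≈⟨ +-congˡ (+-congˡ (*-identityˡ a)) ⟨
    q * L + (q * a + 1# * a)  ≈⟨ +-congˡ (distribʳ a q 1#) ⟨
    q * L + (q + 1#) * a      ∎

  cancel-unit : ∀ {u w x y} → u * w ≈ 1# → u * x ≈ u * y → x ≈ y
  cancel-unit {u} {w} {x} {y} uw≈1 ux≈uy = begin
    x             ≈⟨ *-identityˡ x ⟨
    1# * x        ≈⟨ *-congʳ (trans (*-comm w u) uw≈1) ⟨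
    (w * u) * x   ≈⟨ *-assoc w u x ⟩
    w * (u * x)   ≈⟨ *-congˡ ux≈uy ⟩
    w * (u * y)   ≈⟨ *-assoc w u y ⟨
    (w * u) * y   ≈⟨ *-congʳ (trans (*-comm w u) uw≈1) ⟩
    1# * y        ≈⟨ *-identityˡ y ⟩
    y             ∎

  solve-for-neg : ∀ {q q⁻¹ X Y} → q⁻¹ * q ≈ 1# → q * X + Y ≈ 0# → - X ≈ q⁻¹ * Y
  solve-for-neg {q} {q⁻¹} {X} {Y} q⁻¹q≈1 e = begin
    - X                ≈⟨ -‿cong (trans (*-congʳ q⁻¹q≈1) (*-identityˡ X)) ⟨
    - ((q⁻¹ * q) * X)  ≈⟨ -‿cong (*-assoc _ _ _) ⟩
    - (q⁻¹ * (q * X))  ≈⟨ -‿distribʳ-* _ _ ⟩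
    q⁻¹ * - (q * X)    ≈⟨ *-congˡ (+-inverseʳ-unique (q * X) Y e) ⟨
    q⁻¹ * Y            ∎

  sign-cancel : ∀ {σ} c d τ a → σ * σ ≈ 1# →
                (c * σ) * (d + - ((σ * τ) * a)) ≈ (c * σ) * d + - (τ * (c * a))
  sign-cancel {σ} c d τ a σσ≈1 = trans (x[y-z]≈xy-xz (c * σ) d _) (+-congˡ (-‿cong (begin
    (c * σ) * ((σ * τ) * a) ≈⟨ *-assoc c σ _ ⟩
    c * (σ * ((σ * τ) * a)) ≈⟨ *-congˡ (*-assoc σ _ a) ⟨
    c * ((σ * (σ * τ)) * a) ≈⟨ *-congˡ (*-congʳ (*-assoc σ σ τ)) ⟨
    c * (((σ * σ) * τ) * a) ≈⟨ *-congˡ (*-congʳ (trans (*-congʳ σσ≈1) (*-identityˡ τ))) ⟩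
    c * (τ * a)             ≈⟨ x∙yz≈y∙xz c τ a ⟩
    τ * (c * a)             ∎)))

  sumTo-cong≤ : ∀ r {f g} → (∀ j → j ≤ r → f j ≈ g j) → sumTo r f ≈ sumTo r g
  sumTo-cong≤ zero    e = e 0 z≤n
  sumTo-cong≤ (suc r) e =
    +-cong (sumTo-cong≤ r (λ j j≤r → e j (NP.m≤n⇒m≤1+n j≤r))) (e (suc r) NP.≤-refl)

  sumTo-cong : ∀ r {f g} → (∀ j → f j ≈ g j) → sumTo r f ≈ sumTo r g
  sumTo-cong r e = sumTo-cong≤ r (λ j _ → e j)

  sumTo-+ : ∀ r (f g : ℕ → Carrier) → sumTo r (λ j → f j + g j) ≈ sumTo r f + sumTo r g
  sumTo-+ zero    f g = refl
  sumTo-+ (suc r) f g = trans (+-congʳ (sumTo-+ r f g)) (interchange _ _ _ _)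

  sumTo-* : ∀ r x (f : ℕ → Carrier) → x * sumTo r f ≈ sumTo r (λ j → x * f j)
  sumTo-* zero    x f = refl
  sumTo-* (suc r) x f = trans (distribˡ x _ _) (+-congʳ (sumTo-* r x f))

  sumTo-neg : ∀ r (f : ℕ → Carrier) → sumTo r (λ j → - f j) ≈ - sumTo r f
  sumTo-neg zero    f = refl
  sumTo-neg (suc r) f = trans (+-congʳ (sumTo-neg r f)) (-‿+-comm _ _)

  sumTo-first : ∀ r (f : ℕ → Carrier) → sumTo (suc r) f ≈ f 0 + sumTo r (λ j → f (suc j))
  sumTo-first zero    f = refl
  sumTo-first (suc r) f = trans (+-congʳ (sumTo-first r f)) (+-assoc _ _ _)

  sumTo-δ : ∀ r K (f : ℕ → Carrier) x → sumTo r (λ j → f j * (x * δ0 (j N.+ K))) ≈ f 0 * (x * δ0 K)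
  sumTo-δ zero    K f x = refl
  sumTo-δ (suc r) K f x =
    trans (+-cong (sumTo-δ r K f x) (trans (*-congˡ (zeroʳ x)) (zeroʳ _))) (+-identityʳ _)

  binom : ℕ → ℕ → Carrier
  binom n j = fromℕ' (n C j)

  fromℕ'-+ : ∀ a b → fromℕ' (a N.+ b) ≈ fromℕ' a + fromℕ' b
  fromℕ'-+ zero    b = sym (+-identityˡ _)
  fromℕ'-+ (suc a) b = trans (+-congˡ (fromℕ'-+ a b)) (sym (+-assoc _ _ _))

  binom-zero : ∀ n → binom n 0 ≈ 1#
  binom-zero n = +-identityʳ 1#

  binom-diag : ∀ n → binom n n ≈ 1#
  binom-diag n = trans (reflexive (P.cong fromℕ' (nCn≡1 n))) (binom-zero 0)

  binom-above : ∀ n → binom n (suc n) ≈ 0#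
  binom-above n = reflexive (P.cong fromℕ' (k>n⇒nCk≡0 (NP.n<1+n n)))

  binom-pascal : ∀ n j → binom (suc n) (suc j) ≈ binom n j + binom n (suc j)
  binom-pascal n j = trans (reflexive (P.cong fromℕ' (P.sym (nCk+nC[k+1]≡[n+1]C[k+1] n j))))
                           (fromℕ'-+ (n C j) (n C suc j))

  binomSum-first : ∀ n r (f : ℕ → Carrier) → sumTo (suc r) (λ j → binom n j * f j)
                   ≈ f 0 + sumTo r (λ j → binom n (suc j) * f (suc j))
  binomSum-first n r f =
    trans (sumTo-first r (λ j → binom n j * f j)) (+-congʳ (trans (*-congʳ (binom-zero n)) (*-identityˡ _)))

  pascal-sum : ∀ t (f : ℕ → Carrier) → sumTo (suc t) (λ j → binom (suc t) j * f j)
               ≈ sumTo t (λ j → binom t j * f j) + sumTo t (λ j → binom t j * f (suc j))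
  pascal-sum t f = begin
    sumTo (suc t) (λ j → binom (suc t) j * f j)            ≈⟨ binomSum-first (suc t) t f ⟩
    f 0 + sumTo t (λ j → binom (suc t) (suc j) * f (suc j)) ≈⟨ +-congˡ (sumTo-cong t split) ⟩
    f 0 + sumTo t (λ j → binom t j * f (suc j) + binom t (suc j) * f (suc j))
                                                          ≈⟨ +-congˡ (sumTo-+ t _ _) ⟩
    f 0 + (S' + D)                                        ≈⟨ x∙yz≈xz∙y _ _ _ ⟩
    (f 0 + D) + S'                                        ≈⟨ +-congʳ S≈f0+D ⟨
    S + S'                                                ∎
    where
    S S' D : Carrier
    S  = sumTo t (λ j → binom t j * f j)
    S' = sumTo t (λ j → binom t j * f (suc j))
    D  = sumTo t (λ j → binom t (suc j) * f (suc j))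
    split : ∀ j → binom (suc t) (suc j) * f (suc j) ≈ binom t j * f (suc j) + binom t (suc j) * f (suc j)
    split j = trans (*-congʳ (binom-pascal t j)) (distribʳ _ _ _)
    -- S may be extended by the vanishing term C(t,t+1) f (t+1).
    S≈f0+D : S ≈ f 0 + D
    S≈f0+D = begin
      S                                     ≈⟨ +-identityʳ S ⟨
      S + 0#                                ≈⟨ +-congˡ (trans (*-congʳ (binom-above t)) (zeroˡ _)) ⟨
      sumTo (suc t) (λ j → binom t j * f j) ≈⟨ binomSum-first t t f ⟩
      f 0 + D                               ∎

  sgn-+ : ∀ a b → sgn (a N.+ b) ≈ sgn a * sgn b
  sgn-+ zero    b = sym (*-identityˡ _)
  sgn-+ (suc a) b = trans (*-congˡ (sgn-+ a b)) (sym (*-assoc _ _ _))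

  sgn-square : ∀ a → sgn a * sgn a ≈ 1#
  sgn-square zero    = *-identityˡ 1#
  sgn-square (suc a) = begin
    (- 1# * sgn a) * (- 1# * sgn a) ≈⟨ *-cong (-1*x≈-x _) (-1*x≈-x _) ⟩
    - sgn a * - sgn a               ≈⟨ -‿distribˡ-* _ _ ⟨
    - (sgn a * - sgn a)             ≈⟨ -‿cong (-‿distribʳ-* _ _) ⟨
    - - (sgn a * sgn a)             ≈⟨ -‿involutive _ ⟩
    sgn a * sgn a                   ≈⟨ sgn-square a ⟩
    1#                              ∎

  sgn-even : ∀ k → sgn (2 N.* k) ≈ 1#
  sgn-even k = begin
    sgn (k N.+ (k N.+ 0))  ≈⟨ reflexive (P.cong (λ i → sgn (k N.+ i)) (NP.+-identityʳ k)) ⟩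
    sgn (k N.+ k)          ≈⟨ sgn-+ k k ⟩
    sgn k * sgn k          ≈⟨ sgn-square k ⟩
    1#                     ∎

  sgn-+-even : ∀ j k → sgn (j N.+ 2 N.* k) ≈ sgn j
  sgn-+-even j k = trans (sgn-+ j (2 N.* k)) (trans (*-congˡ (sgn-even k)) (*-identityʳ _))

  -- Umbral sums of a sequence A, writing Eⁿ for A n:
  --   umbralPlus A s t     = Eˢ (E+1)ᵗ = Σ_{j≤t} C(t,j) A (s+j),
  --   umbralMinus A t s    = Eᵗ (E-1)ˢ = Σ_{j≤s} C(s,j) (-1)ʲ A (t+s-j),
  --   umbralOneMinus A t s = Eᵗ (1-E)ˢ = Σ_{j≤s} C(s,j) (-1)ʲ A (t+j).

  umbralPlus : (ℕ → Carrier) → ℕ → ℕ → Carrier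
  umbralPlus A s t = sumTo t (λ j → binom t j * A (s N.+ j))

  umbralMinus : (ℕ → Carrier) → ℕ → ℕ → Carrier
  umbralMinus A t s = sumTo s (λ j → binom s j * (sgn j * A (t N.+ s N.∸ j)))

  umbralOneMinus : (ℕ → Carrier) → ℕ → ℕ → Carrier
  umbralOneMinus A t s = sumTo s (λ j → binom s j * (sgn j * A (t N.+ j)))

  alternatingSum-shift : ∀ s (g : ℕ → Carrier) →
                         sumTo s (λ j → binom s j * (sgn (suc j) * g j))
                         ≈ - sumTo s (λ j → binom s j * (sgn j * g j))
  alternatingSum-shift s g =
    trans (sumTo-cong s (λ j → negate-middle (binom s j) (sgn j) (g j))) (sumTo-neg s _)

  umbralPlus-step : ∀ A s t → umbralPlus A s (suc t) ≈ umbralPlus A s t + umbralPlus A (suc s) t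
  umbralPlus-step A s t = trans (pascal-sum t (λ j → A (s N.+ j)))
    (+-congˡ (sumTo-cong t (λ j → *-congˡ (reflexive (P.cong A (NP.+-suc s j))))))

  umbralOneMinus-step : ∀ A t s →
                        umbralOneMinus A t (suc s) ≈ umbralOneMinus A t s + - umbralOneMinus A (suc t) s
  umbralOneMinus-step A t s = trans (pascal-sum s (λ j → sgn j * A (t N.+ j)))
    (+-congˡ (trans (sumTo-cong s (λ j → *-congˡ (*-congˡ (reflexive (P.cong A (NP.+-suc t j))))))
                    (alternatingSum-shift s (λ j → A (suc t N.+ j)))))

  umbralMinus-step : ∀ A t s →
                     umbralMinus A t (suc s) ≈ umbralMinus A (suc t) s + - umbralMinus A t s
  umbralMinus-step A t s = begin
    umbralMinus A t (suc s)
      ≈⟨ sumTo-cong (suc s) (λ j → *-congˡ (*-congˡ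
           (reflexive (P.cong (λ i → A (i N.∸ j)) (NP.+-suc t s))))) ⟩
    sumTo (suc s) (λ j → binom (suc s) j * f j)
      ≈⟨ pascal-sum s f ⟩
    umbralMinus A (suc t) s + sumTo s (λ j → binom s j * f (suc j))
      ≈⟨ +-congˡ (alternatingSum-shift s (λ j → A (t N.+ s N.∸ j))) ⟩
    umbralMinus A (suc t) s + - umbralMinus A t s ∎
    where
    f : ℕ → Carrier
    f j = sgn j * A (suc (t N.+ s) N.∸ j)

  IsEulerSeq : Carrier → (ℕ → Carrier) → Set ℓ
  IsEulerSeq q A = ∀ t → q * umbralPlus A 0 t + A t ≈ two * δ0 t

  single-term : ∀ x → binom 0 0 * (sgn 0 * x) ≈ x
  single-term x = trans (*-congʳ (binom-zero 0)) (trans (*-identityˡ _) (*-identityˡ x))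

  module EulerIdentities {q : Carrier} {A : ℕ → Carrier} (isEuler : IsEulerSeq q A) where

    A-+0 : ∀ t → A (t N.+ 0) ≈ A t
    A-+0 t = reflexive (P.cong A (NP.+-identityʳ t))

    euler-minus : ∀ s t → q * umbralPlus A s t + umbralMinus A t s ≈ two * (δ0 t * sgn s)
    euler-minus zero t = begin
      q * umbralPlus A 0 t + umbralMinus A t 0 ≈⟨ +-congˡ (trans (single-term _) (A-+0 t)) ⟩
      q * umbralPlus A 0 t + A t               ≈⟨ isEuler t ⟩
      two * δ0 t                               ≈⟨ *-congˡ (*-identityʳ _) ⟨
      two * (δ0 t * sgn 0)                     ∎
    euler-minus (suc s) t = begin
      q * umbralPlus A (suc s) t + umbralMinus A t (suc s)
        ≈⟨ +-congˡ (umbralMinus-step A t s) ⟩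
      q * umbralPlus A (suc s) t + (umbralMinus A (suc t) s + - umbralMinus A t s)
        ≈⟨ subtract-relations q _ _ (umbralPlus-step A s t) ⟩
      (q * umbralPlus A s (suc t) + umbralMinus A (suc t) s) + - (q * umbralPlus A s t + umbralMinus A t s)
        ≈⟨ +-cong (euler-minus s (suc t)) (-‿cong (euler-minus s t)) ⟩
      two * (0# * sgn s) + - (two * (δ0 t * sgn s))
        ≈⟨ +-congʳ (trans (*-congˡ (zeroˡ _)) (zeroʳ two)) ⟩
      0# + - (two * (δ0 t * sgn s))
        ≈⟨ +-identityˡ _ ⟩
      - (two * (δ0 t * sgn s))
        ≈⟨ -‿distribʳ-* two _ ⟩
      two * - (δ0 t * sgn s)
        ≈⟨ *-congˡ (-‿distribʳ-* _ _) ⟩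
      two * (δ0 t * - sgn s)
        ≈⟨ *-congˡ (*-congˡ (-1*x≈-x _)) ⟨
      two * (δ0 t * sgn (suc s)) ∎

    euler-oneMinus : ∀ s t → q * (sgn s * umbralPlus A s t) + umbralOneMinus A t s ≈ two * δ0 t
    euler-oneMinus zero t = begin
      q * (1# * umbralPlus A 0 t) + umbralOneMinus A t 0
        ≈⟨ +-cong (*-congˡ (*-identityˡ _)) (trans (single-term _) (A-+0 t)) ⟩
      q * umbralPlus A 0 t + A t ≈⟨ isEuler t ⟩
      two * δ0 t ∎
    euler-oneMinus (suc s) t = begin
      q * (sgn (suc s) * umbralPlus A (suc s) t) + umbralOneMinus A t (suc s)
        ≈⟨ +-congˡ (umbralOneMinus-step A t s) ⟩
      q * (sgn (suc s) * umbralPlus A (suc s) t) + (umbralOneMinus A t s + - umbralOneMinus A (suc t) s)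
        ≈⟨ subtract-relations q _ _ signed-step ⟩
      (q * (sgn s * umbralPlus A s t) + umbralOneMinus A t s)
        + - (q * (sgn s * umbralPlus A s (suc t)) + umbralOneMinus A (suc t) s)
        ≈⟨ +-cong (euler-oneMinus s t) (-‿cong (euler-oneMinus s (suc t))) ⟩
      two * δ0 t + - (two * 0#) ≈⟨ +-congˡ (trans (-‿cong (zeroʳ two)) -0#≈0#) ⟩
      two * δ0 t + 0#           ≈⟨ +-identityʳ _ ⟩
      two * δ0 t                ∎
      where
      signed-step : sgn s * umbralPlus A s t
                    ≈ sgn s * umbralPlus A s (suc t) + sgn (suc s) * umbralPlus A (suc s) t
      signed-step = sym (begin
        sgn s * umbralPlus A s (suc t) + (- 1# * sgn s) * umbralPlus A (suc s) t
          ≈⟨ +-cong (*-congˡ (umbralPlus-step A s t)) (trans (*-assoc _ _ _) (-1*x≈-x _)) ⟩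
        sgn s * (umbralPlus A s t + umbralPlus A (suc s) t) + - (sgn s * umbralPlus A (suc s) t)
          ≈⟨ +-congʳ (distribˡ _ _ _) ⟩
        (sgn s * umbralPlus A s t + sgn s * umbralPlus A (suc s) t) + - (sgn s * umbralPlus A (suc s) t)
          ≈⟨ move-right refl ⟩
        sgn s * umbralPlus A s t ∎)

  lowerPart : (ℕ → Carrier) → ℕ → Carrier
  lowerPart A zero    = 0#
  lowerPart A (suc m) = sumTo m (λ j → binom (suc m) j * A j)

  umbralPlus-top : ∀ A n → umbralPlus A 0 n ≈ lowerPart A n + A n
  umbralPlus-top A zero    = trans (trans (*-congʳ (binom-zero 0)) (*-identityˡ _)) (sym (+-identityˡ _))
  umbralPlus-top A (suc m) = +-congˡ (trans (*-congʳ (binom-diag (suc m))) (*-identityˡ _))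

  euler-recurrence-top : ∀ q A n → q * umbralPlus A 0 n + A n ≈ q * lowerPart A n + (q + 1#) * A n
  euler-recurrence-top q A n = trans (+-congʳ (*-congˡ (umbralPlus-top A n))) (split-top q _ _)

  euler-unique : ∀ {q w : Carrier} {A B : ℕ → Carrier} → (q + 1#) * w ≈ 1# →
                 IsEulerSeq q A → IsEulerSeq q B → ∀ n → A n ≈ B n
  euler-unique {q} {w} {A} {B} hw isEulerA isEulerB = <-rec (λ n → A n ≈ B n) step
    where
    lower-eq : ∀ n → (∀ {j} → j < n → A j ≈ B j) → lowerPart A n ≈ lowerPart B n
    lower-eq zero    ih = refl
    lower-eq (suc m) ih = sumTo-cong≤ m (λ j j≤m → *-congˡ (ih (s≤s j≤m)))
    step : ∀ n → (∀ {j} → j < n → A j ≈ B j) → A n ≈ B n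
    step n ih = cancel-unit hw (+-cancelˡ (q * lowerPart A n) _ _ (begin
      q * lowerPart A n + (q + 1#) * A n ≈⟨ euler-recurrence-top q A n ⟨
      q * umbralPlus A 0 n + A n         ≈⟨ isEulerA n ⟩
      two * δ0 n                         ≈⟨ isEulerB n ⟨
      q * umbralPlus B 0 n + B n         ≈⟨ euler-recurrence-top q B n ⟩
      q * lowerPart B n + (q + 1#) * B n ≈⟨ +-congʳ (*-congˡ (lower-eq n ih)) ⟨
      q * lowerPart A n + (q + 1#) * B n ∎))

  sumFin-sumTo : ∀ m (f : Fin (suc m) → Carrier) (h : ℕ → Carrier) →
                 (∀ i → f i ≈ h (toℕ i)) → sumFin (suc m) f ≈ sumTo m h
  sumFin-sumTo zero    f h f≈h = trans (+-identityʳ _) (f≈h F.zero)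
  sumFin-sumTo (suc m) f h f≈h = begin
    f (fromℕ (suc m)) + sumFin (suc m) (λ i → f (inject₁ i))
      ≈⟨ +-cong (trans (f≈h _) (reflexive (P.cong h (toℕ-fromℕ (suc m)))))
                (sumFin-sumTo m _ h (λ i → trans (f≈h _) (reflexive (P.cong h (toℕ-inject₁ i))))) ⟩
    h (suc m) + sumTo m h ≈⟨ +-comm _ _ ⟩
    sumTo m h + h (suc m) ∎

  lookup-table : ∀ q w M (i : Fin M) → lookup (table q w M) i P.≡ qEuler q w (toℕ i)
  lookup-table q w (suc M) i with view i
  ... | ‵fromℕ     = P.cong (qEuler q w) (P.sym (toℕ-fromℕ M))
  ... | ‵inject₁ j = P.trans (lookup-∷ʳ-init (table q w M) _ j)
                             (P.trans (lookup-table q w M j) (P.cong (qEuler q w) (P.sym (toℕ-inject₁ j))))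

  qEuler-top : ∀ q w n → qEuler q w n ≈ w * (two * δ0 n + - (q * lowerPart (qEuler q w) n))
  qEuler-top q w n = trans (reflexive (lookup-∷ʳ-last (table q w n) _))
                           (*-congˡ (+-congˡ (-‿cong (*-congˡ (lower n)))))
    where
    lower : ∀ n → sumFin n (λ i → binom n (toℕ i) * lookup (table q w n) i) ≈ lowerPart (qEuler q w) n
    lower zero    = refl
    lower (suc m) = sumFin-sumTo m _ _ (λ i → *-congˡ (reflexive (lookup-table q w (suc m) i)))

  qEuler-isEuler : ∀ {q w} → (q + 1#) * w ≈ 1# → IsEulerSeq q (qEuler q w)
  qEuler-isEuler {q} {w} hw n = begin
    q * umbralPlus E 0 n + E n      ≈⟨ euler-recurrence-top q E n ⟩
    q * L + (q + 1#) * E n          ≈⟨ +-congˡ (*-congˡ (qEuler-top q w n)) ⟩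
    q * L + (q + 1#) * (w * T)      ≈⟨ +-congˡ (*-assoc _ _ _) ⟨
    q * L + ((q + 1#) * w) * T      ≈⟨ +-congˡ (trans (*-congʳ hw) (*-identityˡ T)) ⟩
    q * L + (two * δ0 n + - (q * L)) ≈⟨ add-sub _ _ ⟩
    two * δ0 n                      ∎
    where
    E : ℕ → Carrier
    E = qEuler q w
    L T : Carrier
    L = lowerPart E n
    T = two * δ0 n + - (q * L)

  reflect : (ℕ → Carrier) → ℕ → Carrier
  reflect A n = two * δ0 n + - (sgn n * A n)

  -- Reflection turns Euler sequences for q into Euler sequences for q⁻¹:
  -- (E+1)ⁿ applied to the reflected sequence is 2 - (1-E)ⁿ = q (-1)ⁿ Eⁿ by (Q) at t = 0.
  reflect-isEuler : ∀ {q q⁻¹ : Carrier} {A : ℕ → Carrier} → q⁻¹ * q ≈ 1# → IsEulerSeq q A → IsEulerSeq q⁻¹ (reflect A)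
  reflect-isEuler {q} {q⁻¹} {A} q⁻¹q≈1 isEuler n = begin
    q⁻¹ * umbralPlus (reflect A) 0 n + reflect A n
      ≈⟨ +-congʳ (*-congˡ transform) ⟩
    q⁻¹ * (q * (sgn n * A n)) + reflect A n
      ≈⟨ +-congʳ (trans (sym (*-assoc _ _ _)) (trans (*-congʳ q⁻¹q≈1) (*-identityˡ _))) ⟩
    sgn n * A n + (two * δ0 n + - (sgn n * A n))
      ≈⟨ add-sub _ _ ⟩
    two * δ0 n ∎
    where
    open EulerIdentities isEuler
    transform : umbralPlus (reflect A) 0 n ≈ q * (sgn n * A n)
    transform = begin
      sumTo n (λ j → binom n j * (two * δ0 j + - (sgn j * A j)))
        ≈⟨ sumTo-cong n (λ j → x[y-z]≈xy-xz (binom n j) _ _) ⟩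
      sumTo n (λ j → binom n j * (two * δ0 j) + - (binom n j * (sgn j * A j)))
        ≈⟨ trans (sumTo-+ n _ _) (+-congˡ (sumTo-neg n _)) ⟩
      sumTo n (λ j → binom n j * (two * δ0 j)) + - umbralOneMinus A 0 n
        ≈⟨ +-congʳ (sumTo-cong n (λ j → *-congˡ (*-congˡ
             (reflexive (P.cong δ0 (P.sym (NP.+-identityʳ j))))))) ⟩
      sumTo n (λ j → binom n j * (two * δ0 (j N.+ 0))) + - umbralOneMinus A 0 n
        ≈⟨ +-congʳ (trans (sumTo-δ n 0 (binom n) two) (trans (*-congʳ (binom-zero n)) (*-identityˡ _))) ⟩
      two * 1# + - umbralOneMinus A 0 n
        ≈⟨ move-right (trans (+-congʳ (*-congˡ (*-congˡ (sym top-term)))) (euler-oneMinus n 0)) ⟩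
      q * (sgn n * A n) ∎
      where
      top-term : umbralPlus A n 0 ≈ A n
      top-term = trans (*-congʳ (binom-zero 0)) (trans (*-identityˡ _) (A-+0 n))

  qEuler-reflection : ∀ {q q⁻¹ w w'} → q * q⁻¹ ≈ 1# →
                      (q + 1#) * w ≈ 1# → (q⁻¹ + 1#) * w' ≈ 1# →
                      ∀ n → qEuler q⁻¹ w' n ≈ reflect (qEuler q w) n
  qEuler-reflection hq hw hw' =
    euler-unique hw' (qEuler-isEuler hw') (reflect-isEuler (trans (*-comm _ _) hq) (qEuler-isEuler hw))

  δ0-pos : ∀ {r} → 0 < r → δ0 r P.≡ 0#
  δ0-pos {suc r} _ = P.refl

  -- The reflected sequence contributes 2 δ_K - (-1)ᴷ Eᴷ (E+1)ʳ, and (P) with t = r > 0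
  -- gives q Eᴷ (E+1)ʳ = - Eʳ (E-1)ᴷ.
  alternating-reflected-sum : ∀ {q q⁻¹ : Carrier} {A B : ℕ → Carrier} →
    q⁻¹ * q ≈ 1# → IsEulerSeq q A →
    (∀ n → B n ≈ reflect A n) → ∀ r K → 0 < r →
    sumTo r (λ j → (binom r j * sgn j) * B (j N.+ K)) ≈ two * δ0 K + sgn K * (q⁻¹ * umbralMinus A r K)
  alternating-reflected-sum {q} {q⁻¹} {A} {B} q⁻¹q≈1 isEuler B≈reflectA r K 0<r = begin
    sumTo r (λ j → (binom r j * sgn j) * B (j N.+ K))
      ≈⟨ sumTo-cong r term ⟩
    sumTo r (λ j → (binom r j * sgn j) * (two * δ0 (j N.+ K)) + - (sgn K * (binom r j * A (K N.+ j))))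
      ≈⟨ trans (sumTo-+ r _ _) (+-congˡ (trans (sumTo-neg r _) (-‿cong (sym (sumTo-* r (sgn K) _))))) ⟩
    sumTo r (λ j → (binom r j * sgn j) * (two * δ0 (j N.+ K))) + - (sgn K * umbralPlus A K r)
      ≈⟨ +-cong (sumTo-δ r K _ two) (-‿distribʳ-* _ _) ⟩
    (binom r 0 * 1#) * (two * δ0 K) + sgn K * - umbralPlus A K r
      ≈⟨ +-cong (trans (*-congʳ (trans (*-identityʳ _) (binom-zero r))) (*-identityˡ _))
                (*-congˡ (solve-for-neg q⁻¹q≈1 P-vanishes)) ⟩
    two * δ0 K + sgn K * (q⁻¹ * umbralMinus A r K) ∎
    where
    open EulerIdentities isEuler
    term : ∀ j → (binom r j * sgn j) * B (j N.+ K)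
                 ≈ (binom r j * sgn j) * (two * δ0 (j N.+ K)) + - (sgn K * (binom r j * A (K N.+ j)))
    term j = begin
      (binom r j * sgn j) * B (j N.+ K)
        ≈⟨ *-congˡ (B≈reflectA (j N.+ K)) ⟩
      (binom r j * sgn j) * (two * δ0 (j N.+ K) + - (sgn (j N.+ K) * A (j N.+ K)))
        ≈⟨ *-congˡ (+-congˡ (-‿cong (*-cong (sgn-+ j K) (reflexive (P.cong A (NP.+-comm j K)))))) ⟩
      (binom r j * sgn j) * (two * δ0 (j N.+ K) + - ((sgn j * sgn K) * A (K N.+ j)))
        ≈⟨ sign-cancel _ _ _ _ (sgn-square j) ⟩
      (binom r j * sgn j) * (two * δ0 (j N.+ K)) + - (sgn K * (binom r j * A (K N.+ j))) ∎
    P-vanishes : q * umbralPlus A K r + umbralMinus A r K ≈ 0#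
    P-vanishes = trans (euler-minus K r)
      (trans (*-congˡ (trans (*-congʳ (reflexive (δ0-pos 0<r))) (zeroˡ _))) (zeroʳ two))

  even-cases : ∀ q⁻¹ (A : ℕ → Carrier) M k → 2 N.* k ≤ M →
    two * δ0 (2 N.* k) + q⁻¹ * umbralMinus A (M N.∸ 2 N.* k) (2 N.* k)
    ≈ case0 k (two + q⁻¹ * A M)
              (q⁻¹ * sumTo (2 N.* k) (λ j → (binom (2 N.* k) j * sgn (j N.+ 2 N.* k)) * A (M N.∸ j)))
  even-cases q⁻¹ A M zero    _    =
    +-cong (*-identityʳ two) (*-congˡ (trans (single-term _) (reflexive (P.cong A (NP.+-identityʳ M)))))
  even-cases q⁻¹ A M (suc k) 2k≤M = begin
    two * 0# + q⁻¹ * umbralMinus A (M N.∸ K) K ≈⟨ trans (+-congʳ (zeroʳ two)) (+-identityˡ _) ⟩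
    q⁻¹ * umbralMinus A (M N.∸ K) K          ≈⟨ *-congˡ (sumTo-cong K term) ⟩
    q⁻¹ * sumTo K (λ j → (binom K j * sgn (j N.+ K)) * A (M N.∸ j)) ∎
    where
    K : ℕ
    K = 2 N.* suc k
    term : ∀ j → binom K j * (sgn j * A (M N.∸ K N.+ K N.∸ j))
                 ≈ (binom K j * sgn (j N.+ K)) * A (M N.∸ j)
    term j = trans (sym (*-assoc _ _ _))
      (*-cong (*-congˡ (sym (sgn-+-even j (suc k))))
              (reflexive (P.cong (λ i → A (i N.∸ j)) (NP.m∸n+n≡m 2k≤M))))

corollary7 : {c ℓ : Level} (R : CommutativeRing c ℓ) →
    let open QEuler R in
    (q q⁻¹ w w' : Carrier) →
    q * q⁻¹ ≈ 1# →
    (q + 1#) * w ≈ 1# →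
    (q⁻¹ + 1#) * w' ≈ 1# →
    (m n k : ℕ) → 2 N.* k N.< m N.+ n →
    sumTo (n N.+ m N.∸ 2 N.* k)
      (λ j → (fromℕ' ((n N.+ m N.∸ 2 N.* k) C j) * sgn j) * qEuler q⁻¹ w' (j N.+ 2 N.* k))
    ≈
    case0 k
      ((1# + 1#) + q⁻¹ * qEuler q w (n N.+ m))
      (q⁻¹ * sumTo (2 N.* k)
        (λ j → (fromℕ' ((2 N.* k) C j) * sgn (j N.+ 2 N.* k)) * qEuler q w (n N.+ m N.∸ j)))
corollary7 R q q⁻¹ w w' hq hw hw' m n k 2k<m+n = begin
    sumTo r (λ j → (binom r j * sgn j) * qEuler q⁻¹ w' (j N.+ K))
      ≈⟨ alternating-reflected-sum q⁻¹q≈1 (qEuler-isEuler hw) (qEuler-reflection hq hw hw') r K 0<r ⟩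
    two * δ0 K + sgn K * (q⁻¹ * umbralMinus E r K)
      ≈⟨ +-congˡ (trans (*-congʳ (sgn-even k)) (*-identityˡ _)) ⟩
    two * δ0 K + q⁻¹ * umbralMinus E r K
      ≈⟨ even-cases q⁻¹ E (n N.+ m) k (NP.<⇒≤ 2k<n+m) ⟩
    case0 k (two + q⁻¹ * E (n N.+ m))
            (q⁻¹ * sumTo K (λ j → (binom K j * sgn (j N.+ K)) * E (n N.+ m N.∸ j))) ∎
  where
  open QEuler R
  open QEulerProperties R
  open SetoidReasoning setoid
  E : ℕ → Carrier
  E = qEuler q w
  K r : ℕ
  K = 2 N.* k
  r = n N.+ m N.∸ K
  q⁻¹q≈1 : q⁻¹ * q ≈ 1#
  q⁻¹q≈1 = trans (*-comm q⁻¹ q) hq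
  2k<n+m : K < n N.+ m
  2k<n+m = P.subst (K <_) (NP.+-comm m n) 2k<m+n
  0<r : 0 < r
  0<r = NP.m<n⇒0<n∸m 2k<n+m
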